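{- Up to isomorphism, the minimal signed Petersen graphs are precisely the six signed graphs $+P$, $P_1$, $P_{2,2}$, $P_{3,2}$, $P_{2,3}$, $P_{3,3}$. Each of these is the unique isomorphism type of minimal signed graph in its switching isomorphism class. Their frustration indices are $l(+P)=0$, $l(P_1)=1$, $l(P_{2,2})=2$, $l(P_{2,3})=2$, $l(P_{3,2})=3$, $l(P_{3,3})=3$.
   Context: The Petersen graph $P$ has vertices $v_{ij}$ indexed by the 2-element subsets $\{i,j\}$ of $\{1,\dots,5\}$, with $v_{ij}v_{kl}$ an edge iff $\{i,j\}\cap\{k,l\}=\emptyset$. A signed graph $\Sigma=(\Gamma,\sigma)$ has signature $\sigma:E\to\{+,-\}$; $E^-$ is its set of negative edges. It is balanced if every cycle has positive sign product. The frustration index $l(\Sigma)$ is the smallest number of edges whose deletion leaves a balanced signed graph. $\Sigma$ is called minimal if $|E^-(\Sigma)|=l(\Sigma)$. Switching by $\zeta:V\to\{+,-\}$ gives $\sigma^\zeta(vw)=\zeta(v)\sigma(vw)\zeta(w)$; two signed graphs are switching isomorphic if one is isomorphic (via a sign-preserving graph isomorphism) to a switching of the other. Edge distance is distance in the line graph; in $P$ two disjoint edges are at distance 2 if some edge joins an endpoint of one to an endpoint of the other, and at distance 3 otherwise. $+P$: all edges positive; $P_1$: exactly one negative edge; $P_{2,2}$ / $P_{2,3}$: exactly two negative edges at distance 2 / 3; $P_{3,2}$: exactly three negative edges forming alternate edges of a 6-cycle of $P$; $P_{3,3}$: exactly three negative edges pairwise at distance 3. -}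

module Defs where

open import Data.Bool using (Bool; true; false; _∧_; _∨_; not; _xor_; if_then_else_; T)
open import Data.Nat using (ℕ; _≤_; _<ᵇ_)
open import Data.Fin using (Fin; toℕ; _≟_; zero; suc; #_)
open import Data.List using (List; []; _∷_; _++_; [_]; length; filterᵇ; zip; foldr; cartesianProduct; map)
open import Data.List.Base using (allFin)
open import Data.List.Relation.Unary.All using (All)
open import Data.List.Relation.Unary.Unique.Propositional using (Unique)
open import Data.Product using (Σ; _×_; _,_; ∃; proj₁; proj₂)
open import Data.Fin.Permutation using (Permutation′; _⟨$⟩ʳ_)
open import Relation.Binary.PropositionalEquality using (_≡_; refl; trans; cong)
open import Relation.Nullary.Decidable using (⌊_⌋)

-- The Petersen graph P.
-- Vertices are the 10 two-element subsets of {1,…,5}; we index them by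
-- Fin 10 and use Fin 5 = {0,…,4} for {1,…,5}.  `pair v` is the subset.

Vertex : Set
Vertex = Fin 10

pair : Vertex → Fin 5 × Fin 5
pair zero = (# 0 , # 1)
pair (suc zero) = (# 0 , # 2)
pair (suc (suc zero)) = (# 0 , # 3)
pair (suc (suc (suc zero))) = (# 0 , # 4)
pair (suc (suc (suc (suc zero)))) = (# 1 , # 2)
pair (suc (suc (suc (suc (suc zero))))) = (# 1 , # 3)
pair (suc (suc (suc (suc (suc (suc zero)))))) = (# 1 , # 4)
pair (suc (suc (suc (suc (suc (suc (suc zero))))))) = (# 2 , # 3)
pair (suc (suc (suc (suc (suc (suc (suc (suc zero)))))))) = (# 2 , # 4)
pair (suc (suc (suc (suc (suc (suc (suc (suc (suc zero))))))))) = (# 3 , # 4)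

_==_ : Fin 5 → Fin 5 → Bool
i == j = ⌊ i ≟ j ⌋

adj : Vertex → Vertex → Bool
adj u v with pair u | pair v
... | (i , j) | (k , l) = not ((i == k) ∨ (i == l) ∨ (j == k) ∨ (j == l))

Adj : Vertex → Vertex → Set
Adj u v = T (adj u v)

edges : List (Vertex × Vertex)
edges = filterᵇ (λ p → adj (proj₁ p) (proj₂ p) ∧ (toℕ (proj₁ p) <ᵇ toℕ (proj₂ p)))
               (cartesianProduct (allFin 10) (allFin 10))

-- Sets of edges of P, given by a symmetric Boolean function on vertex
-- pairs (only its values on edges matter).

record EdgeSet : Set where
  field
    mem : Vertex → Vertex → Bool
    sym : ∀ u v → mem u v ≡ mem v u
open EdgeSet public

∣_∣ₑ : EdgeSet → ℕ
∣ S ∣ₑ = length (filterᵇ (λ p → mem S (proj₁ p) (proj₂ p)) edges)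

-- Signed Petersen graphs: a signature is determined by its set E⁻ of
-- negative edges (mem σ u v ≡ true  iff  σ(uv) = −).

SignedPetersen : Set
SignedPetersen = EdgeSet

negCount : SignedPetersen → ℕ
negCount Σ' = ∣ Σ' ∣ₑ

cycleEdges : List Vertex → List (Vertex × Vertex)
cycleEdges [] = []
cycleEdges (v ∷ vs) = zip (v ∷ vs) (vs ++ [ v ])

-- sign of a cycle: true = negative (odd number of negative edges)
cycleNeg : SignedPetersen → List Vertex → Bool
cycleNeg Σ' c = foldr (λ p b → mem Σ' (proj₁ p) (proj₂ p) xor b) false (cycleEdges c)

BalancedAfterDeleting : SignedPetersen → EdgeSet → Set
BalancedAfterDeleting Σ' S =
  (c : List Vertex) → 3 ≤ length c → Unique c →
  All (λ p → Adj (proj₁ p) (proj₂ p) × mem S (proj₁ p) (proj₂ p) ≡ false) (cycleEdges c) →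
  cycleNeg Σ' c ≡ false

FrustrationIndex : SignedPetersen → ℕ → Set
FrustrationIndex Σ' k =
  (Σ (EdgeSet) λ S → ∣ S ∣ₑ ≡ k × BalancedAfterDeleting Σ' S) ×
  ((S : EdgeSet) → BalancedAfterDeleting Σ' S → k ≤ ∣ S ∣ₑ)

Minimal : SignedPetersen → Set
Minimal Σ' = FrustrationIndex Σ' (negCount Σ')

switch : SignedPetersen → (Vertex → Bool) → SignedPetersen
switch Σ' ζ = record
  { mem = λ u v → ζ u xor (mem Σ' u v xor ζ v)
  ; sym = λ u v → lemma (ζ u) (ζ v) (mem Σ' u v) (mem Σ' v u) (EdgeSet.sym Σ' u v) }
  where
  lemma : ∀ a b x y → x ≡ y → a xor (x xor b) ≡ b xor (y xor a)
  lemma false false false .false refl = refl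
  lemma false false true .true refl = refl
  lemma false true false .false refl = refl
  lemma false true true .true refl = refl
  lemma true false false .false refl = refl
  lemma true false true .true refl = refl
  lemma true true false .false refl = refl
  lemma true true true .true refl = refl

_≅_ : SignedPetersen → SignedPetersen → Set
Σ₁ ≅ Σ₂ = Σ (Permutation′ 10) λ f →
  ((u v : Vertex) → adj (f ⟨$⟩ʳ u) (f ⟨$⟩ʳ v) ≡ adj u v) ×
  ((u v : Vertex) → Adj u v → mem Σ₂ (f ⟨$⟩ʳ u) (f ⟨$⟩ʳ v) ≡ mem Σ₁ u v)

_~_ : SignedPetersen → SignedPetersen → Set
Σ₁ ~ Σ₂ = Σ (Vertex → Bool) λ ζ → switch Σ₁ ζ ≅ Σ₂

_≡ᵇ_ : Vertex → Vertex → Bool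
u ≡ᵇ v = ⌊ u ≟ v ⌋

inList : List (Vertex × Vertex) → Vertex → Vertex → Bool
inList [] u v = false
inList ((a , b) ∷ es) u v = ((a ≡ᵇ u ∧ b ≡ᵇ v) ∨ (a ≡ᵇ v ∧ b ≡ᵇ u)) ∨ inList es u v

private
  ∨-comm : ∀ x y → (x ∨ y) ≡ (y ∨ x)
  ∨-comm false false = refl
  ∨-comm false true = refl
  ∨-comm true false = refl
  ∨-comm true true = refl

  inList-sym : ∀ es u v → inList es u v ≡ inList es v u
  inList-sym [] u v = refl
  inList-sym ((a , b) ∷ es) u v
    rewrite ∨-comm (a ≡ᵇ u ∧ b ≡ᵇ v) (a ≡ᵇ v ∧ b ≡ᵇ u) | inList-sym es u v = refl

negatives : List (Vertex × Vertex) → SignedPetersen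
negatives es = record { mem = inList es ; sym = inList-sym es }

-- Vertex numbering: 0={1,2} 1={1,3} 2={1,4} 3={1,5} 4={2,3}
--                   5={2,4} 6={2,5} 7={3,4} 8={3,5} 9={4,5}

+P : SignedPetersen
+P = negatives []

P₁ : SignedPetersen
P₁ = negatives ((# 0 , # 7) ∷ [])

-- P₂,₂ : v12 v34 and v14 v35 (distance 2: v12 v35 is an edge)
P₂₂ : SignedPetersen
P₂₂ = negatives ((# 0 , # 7) ∷ (# 2 , # 8) ∷ [])

-- P₂,₃ : v12 v34 and v13 v24 (distance 3)
P₂₃ : SignedPetersen
P₂₃ = negatives ((# 0 , # 7) ∷ (# 1 , # 5) ∷ [])

-- P₃,₂ : alternate edges v12v34, v15v24, v13v45 of the 6-cycle
--        v12 v34 v15 v24 v13 v45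
P₃₂ : SignedPetersen
P₃₂ = negatives ((# 0 , # 7) ∷ (# 3 , # 5) ∷ (# 1 , # 9) ∷ [])

-- P₃,₃ : v12v34, v13v24, v14v23, pairwise at distance 3
P₃₃ : SignedPetersen
P₃₃ = negatives ((# 0 , # 7) ∷ (# 1 , # 5) ∷ (# 2 , # 4) ∷ [])

six : Fin 6 → SignedPetersen
six zero = +P
six (suc zero) = P₁
six (suc (suc zero)) = P₂₂
six (suc (suc (suc zero))) = P₃₂
six (suc (suc (suc (suc zero)))) = P₂₃
six (suc (suc (suc (suc (suc zero))))) = P₃₃

module Submission where

-- Switching at a vertex set X flips the signs of exactly the edges of the cut δX and keeps every cycle sign, so the
-- negative edges of any switching of Σ form a balancing set of Σ, and in a minimal Σ at most half of every cut is
-- negative. Searching all 2¹⁵ signatures with this pruning (for single vertices and 2-paths) leaves only images of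
-- the six under automorphisms of P, which are induced by permutations of {1,…,5}. Conversely each of the six is
-- minimal, because every set of fewer than |E⁻| edges misses a negative pentagon, and minimality transfers along
-- automorphisms, which preserve edge counts (double counting over ordered pairs). Finally, which numbers of negative
-- pentagons occur in a pair of complementary pentagons (a frame) depends only on the cycle signs up to automorphism,
-- and this separates the six switching classes.

open import Defs hiding (sym)

open import Algebra.Bundles using (CommutativeRing)
import Algebra.Properties.CommutativeSemigroup as CommutativeSemigroupProperties
open import Data.Bool using (Bool; true; false; _∧_; _∨_; not; _xor_; T; if_then_else_)
import Data.Bool as Bool
open import Data.Bool.ListAction using (any; all)
open import Data.Bool.Properties using (T?; T-∨; T-∧; T-not-≡; xor-∧-commutativeRing; xor-assoc; xor-same; xor-identityʳ)
open import Data.Empty using (⊥-elim)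
open import Data.Fin using (Fin; zero; suc; toℕ; #_; _≟_)
open import Data.Fin.Permutation using (Permutation′; permutation; _⟨$⟩ʳ_; _⟨$⟩ˡ_; inverseˡ; inverseʳ; flip; _∘ₚ_)
open import Data.Fin.Properties using (all?; any?)
open import Data.List
  using ( List; []; _∷_; _++_; [_]; length; map; zip; zipWith; foldr; filterᵇ; findᵇ; concatMap; tabulate; allFin
        ; cartesianProduct)
open import Data.List.Membership.Propositional using (_∈_; find)
open import Data.List.Membership.Propositional.Properties using (∈-map⁻)
open import Data.List.Properties
  using (≡-dec; ++-identityʳ; ++-assoc; map-cong; map-id; map-++; map-∘; map-tabulate; zip-map; length-map)
open import Data.List.Relation.Unary.All as All using (All; []; _∷_)
import Data.List.Relation.Unary.All.Properties as AllP
open import Data.List.Relation.Unary.Any as Any using (here; there)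
import Data.List.Relation.Unary.Any.Properties as AnyP
open import Data.List.Relation.Unary.Unique.Propositional using (Unique)
import Data.List.Relation.Unary.Unique.Propositional.Properties as UniqueP
open import Data.List.Relation.Unary.Unique.DecPropositional (_≟_ {10}) using (unique?)
open import Data.Maybe using (fromMaybe)
open import Data.Nat using (ℕ; zero; suc; _+_; _*_; _<_; _≤_; _<ᵇ_; _≤ᵇ_; z≤n; s≤s)
import Data.Nat as ℕ
open import Data.Nat.ListAction using (sum)
open import Data.Nat.ListAction.Properties using (sum-++)
open import Data.Nat.Properties
  using ( +-0-commutativeMonoid; +-suc; +-identityʳ; +-mono-≤; +-monoʳ-<; +-cancelˡ-<; +-cancelʳ-<; *-cancelˡ-≡
        ; ≤-trans; <-≤-trans; <-irrefl; m≤m+n; ≤ᵇ⇒≤; ≤⇒≤ᵇ; <ᵇ⇒<; <⇒<ᵇ; module ≤-Reasoning)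
open import Data.Product using (Σ; _×_; _,_; proj₁; proj₂)
import Data.Product as Product
open import Data.Product.Properties using () renaming (≡-dec to ×-≡-dec)
open import Data.List.Membership.DecPropositional (×-≡-dec (_≟_ {10}) (_≟_ {10})) using (_∈?_)
open import Data.Sum using (_⊎_; inj₁; inj₂; [_,_]′)
open import Data.Unit using (tt)
open import Data.Vec using (Vec)
import Data.Vec as Vec
open import Function using (id; _∘_)
open import Function.Bundles using (_⇔_; mk⇔; Equivalence)
open import Function.Definitions using (StrictlyInverseˡ; StrictlyInverseʳ)
open import Relation.Binary.PropositionalEquality
  using (_≡_; refl; sym; trans; cong; cong₂; subst; subst₂; module ≡-Reasoning)
open import Relation.Nullary using (¬_; Dec; does; yes; no)
open import Relation.Nullary.Decidable using (⌊_⌋; toWitness; from-yes; _→-dec_; _×-dec_; does-⇔)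

open import Algebra.Properties.CommutativeMonoid.Sum +-0-commutativeMonoid
  using (sum-syntax; sum-cong-≗; ∑-distrib-+; ∑-comm; ∑-permute)
open CommutativeSemigroupProperties (CommutativeRing.+-commutativeSemigroup xor-∧-commutativeRing)
  using (interchange; x∙yz≈y∙xz)

Edge : Set
Edge = Vertex × Vertex

-- `edges` of Defs in normal form: the exhaustive checks below would otherwise recompute the filter each time.
edgeList : List Edge
edgeList = (# 0 , # 7) ∷ (# 0 , # 8) ∷ (# 0 , # 9) ∷ (# 1 , # 5) ∷ (# 1 , # 6) ∷ (# 1 , # 9) ∷ (# 2 , # 4) ∷ (# 2 , # 6)
         ∷ (# 2 , # 8) ∷ (# 3 , # 4) ∷ (# 3 , # 5) ∷ (# 3 , # 7) ∷ (# 4 , # 9) ∷ (# 5 , # 8) ∷ (# 6 , # 7) ∷ []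

adj-sym : ∀ u v → adj u v ≡ adj v u
adj-sym = from-yes (all? λ u → all? λ v → adj u v Bool.≟ adj v u)

ordered : Vertex → Vertex → Edge
ordered u v = if toℕ u <ᵇ toℕ v then (u , v) else (v , u)

ordered-∈-edgeList : ∀ u v → Adj u v → ordered u v ∈ edgeList
ordered-∈-edgeList = from-yes (all? λ u → all? λ v → T? (adj u v) →-dec ordered u v ∈? edgeList)

mem-ordered : ∀ X u v → mem X (proj₁ (ordered u v)) (proj₂ (ordered u v)) ≡ mem X u v
mem-ordered X u v with toℕ u <ᵇ toℕ v
... | true = refl
... | false = EdgeSet.sym X v u

ones : List Bool → ℕ
ones [] = 0
ones (true ∷ bs) = suc (ones bs)
ones (false ∷ bs) = ones bs

ones-++ : ∀ p q → ones (p ++ q) ≡ ones p + ones q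
ones-++ [] q = refl
ones-++ (true ∷ p) q = cong suc (ones-++ p q)
ones-++ (false ∷ p) q = ones-++ p q

length-filterᵇ : ∀ {A : Set} (p : A → Bool) xs → length (filterᵇ p xs) ≡ ones (map p xs)
length-filterᵇ p [] = refl
length-filterᵇ p (x ∷ xs) with p x
... | true = cong suc (length-filterᵇ p xs)
... | false = length-filterᵇ p xs

zipWith-map-map : ∀ {A : Set} (f : Bool → Bool → Bool) (s k : A → Bool) xs →
                  zipWith f (map s xs) (map k xs) ≡ map (λ x → f (s x) (k x)) xs
zipWith-map-map f s k [] = refl
zipWith-map-map f s k (x ∷ xs) = cong (f (s x) (k x) ∷_) (zipWith-map-map f s k xs)

zip-map-self : ∀ {A B : Set} (f : A → B) xs → zip xs (map f xs) ≡ map (λ x → x , f x) xs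
zip-map-self f [] = refl
zip-map-self f (x ∷ xs) = cong ((x , f x) ∷_) (zip-map-self f xs)

onesOn : List Bool → List Bool → ℕ
onesOn p m = ones (zipWith _∧_ p m)

onesOn-++ : ∀ p q m → onesOn p m ≤ onesOn (p ++ q) m
onesOn-++ [] q m = z≤n
onesOn-++ (b ∷ p) q [] = z≤n
onesOn-++ (true ∷ p) q (true ∷ m) = s≤s (onesOn-++ p q m)
onesOn-++ (true ∷ p) q (false ∷ m) = onesOn-++ p q m
onesOn-++ (false ∷ p) q (c ∷ m) = onesOn-++ p q m

bitsOf : EdgeSet → List Bool
bitsOf X = map (λ e → mem X (proj₁ e) (proj₂ e)) edgeList

∣∣ₑ≡ones-bitsOf : ∀ X → ∣ X ∣ₑ ≡ ones (bitsOf X)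
∣∣ₑ≡ones-bitsOf X = length-filterᵇ (λ e → mem X (proj₁ e) (proj₂ e)) edgeList

module _ {A : Set} (s k : A → Bool) where

  ones-xor : ∀ xs → ones (map (λ x → s x xor k x) xs) + ones (map (λ x → s x ∧ k x) xs)
                  ≡ ones (map s xs) + ones (map (λ x → not (s x) ∧ k x) xs)
  ones-xor [] = refl
  ones-xor (x ∷ xs) with s x | k x
  ... | true  | true  = trans (+-suc _ _) (cong suc (ones-xor xs))
  ... | true  | false = cong suc (ones-xor xs)
  ... | false | true  = trans (cong suc (ones-xor xs)) (sym (+-suc _ _))
  ... | false | false = ones-xor xs

  ones-split : ∀ xs → ones (map (λ x → s x ∧ k x) xs) + ones (map (λ x → not (s x) ∧ k x) xs) ≡ ones (map k xs)
  ones-split [] = refl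
  ones-split (x ∷ xs) with s x | k x
  ... | true  | true  = cong suc (ones-split xs)
  ... | true  | false = ones-split xs
  ... | false | true  = trans (+-suc _ _) (cong suc (ones-split xs))
  ... | false | false = ones-split xs

  ones-xor-< : ∀ xs → ones (map k xs) < ones (map (λ x → s x ∧ k x) xs) + ones (map (λ x → s x ∧ k x) xs) →
               ones (map (λ x → s x xor k x) xs) < ones (map s xs)
  ones-xor-< xs heavy = +-cancelʳ-< both _ _ (begin-strict
      ones (map (λ x → s x xor k x) xs) + both ≡⟨ ones-xor xs ⟩
      ones (map s xs) + onlyK                   <⟨ +-monoʳ-< (ones (map s xs)) onlyK<both ⟩
      ones (map s xs) + both                    ∎)
    where
    open ≤-Reasoning
    both = ones (map (λ x → s x ∧ k x) xs)
    onlyK = ones (map (λ x → not (s x) ∧ k x) xs)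
    onlyK<both : onlyK < both
    onlyK<both = +-cancelˡ-< both onlyK both (subst (_< both + both) (sym (ones-split xs)) heavy)

-- Switching

-- true = negative; cycleNeg Σ c is parity (mem Σ) (cycleEdges c).
parity : (Vertex → Vertex → Bool) → List Edge → Bool
parity σ = foldr (λ e b → σ (proj₁ e) (proj₂ e) xor b) false

parity-all-false : ∀ {σ} es → All (λ e → σ (proj₁ e) (proj₂ e) ≡ false) es → parity σ es ≡ false
parity-all-false [] [] = refl
parity-all-false (e ∷ es) (σe≡false ∷ rest) = cong₂ _xor_ σe≡false (parity-all-false es rest)

parity-xor : ∀ σ τ es → parity (λ u v → σ u v xor τ u v) es ≡ parity σ es xor parity τ es
parity-xor σ τ [] = refl
parity-xor σ τ ((u , v) ∷ es) = trans (cong ((σ u v xor τ u v) xor_) (parity-xor σ τ es))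
                                      (interchange (σ u v) (τ u v) (parity σ es) (parity τ es))

coboundary : (Vertex → Bool) → Vertex → Vertex → Bool
coboundary ζ u v = ζ u xor ζ v

parity-coboundary-path : ∀ ζ x ys z → parity (coboundary ζ) (zip (x ∷ ys) (ys ++ [ z ])) ≡ ζ x xor ζ z
parity-coboundary-path ζ x [] z = xor-identityʳ (ζ x xor ζ z)
parity-coboundary-path ζ x (y ∷ ys) z = begin
  (ζ x xor ζ y) xor parity (coboundary ζ) (zip (y ∷ ys) (ys ++ [ z ]))
    ≡⟨ cong ((ζ x xor ζ y) xor_) (parity-coboundary-path ζ y ys z) ⟩
  (ζ x xor ζ y) xor (ζ y xor ζ z)  ≡⟨ xor-assoc (ζ x) (ζ y) (ζ y xor ζ z) ⟩
  ζ x xor (ζ y xor (ζ y xor ζ z))  ≡⟨ cong (ζ x xor_) (sym (xor-assoc (ζ y) (ζ y) (ζ z))) ⟩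
  ζ x xor ((ζ y xor ζ y) xor ζ z)  ≡⟨ cong (λ b → ζ x xor (b xor ζ z)) (xor-same (ζ y)) ⟩
  ζ x xor ζ z                      ∎
  where open ≡-Reasoning

parity-coboundary-cycle : ∀ ζ c → parity (coboundary ζ) (cycleEdges c) ≡ false
parity-coboundary-cycle ζ [] = refl
parity-coboundary-cycle ζ (v ∷ vs) = trans (parity-coboundary-path ζ v vs v) (xor-same (ζ v))

switch-mem : ∀ Σ' ζ u v → mem (switch Σ' ζ) u v ≡ mem Σ' u v xor coboundary ζ u v
switch-mem Σ' ζ u v = x∙yz≈y∙xz (ζ u) (mem Σ' u v) (ζ v)

switch-cycleNeg : ∀ Σ' ζ c → cycleNeg (switch Σ' ζ) c ≡ cycleNeg Σ' c
switch-cycleNeg Σ' ζ c = begin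
  parity (mem (switch Σ' ζ)) (cycleEdges c)
    ≡⟨ parity-cong (cycleEdges c) ⟩
  parity (λ u v → mem Σ' u v xor coboundary ζ u v) (cycleEdges c)
    ≡⟨ parity-xor (mem Σ') (coboundary ζ) (cycleEdges c) ⟩
  parity (mem Σ') (cycleEdges c) xor parity (coboundary ζ) (cycleEdges c)
    ≡⟨ cong (cycleNeg Σ' c xor_) (parity-coboundary-cycle ζ c) ⟩
  parity (mem Σ') (cycleEdges c) xor false
    ≡⟨ xor-identityʳ _ ⟩
  cycleNeg Σ' c
    ∎
  where
  open ≡-Reasoning
  parity-cong : ∀ es → parity (mem (switch Σ' ζ)) es ≡ parity (λ u v → mem Σ' u v xor coboundary ζ u v) es
  parity-cong [] = refl
  parity-cong ((u , v) ∷ es) = cong₂ _xor_ (switch-mem Σ' ζ u v) (parity-cong es)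

balanced-deleting-negatives : ∀ Σ' → BalancedAfterDeleting Σ' Σ'
balanced-deleting-negatives Σ' c _ _ avoids = parity-all-false (cycleEdges c) (All.map proj₂ avoids)

balanced-deleting-switch : ∀ Σ' ζ → BalancedAfterDeleting Σ' (switch Σ' ζ)
balanced-deleting-switch Σ' ζ c _ _ avoids =
  trans (sym (switch-cycleNeg Σ' ζ c)) (parity-all-false (cycleEdges c) (All.map proj₂ avoids))

minimal-≤-switch : ∀ {Σ'} → Minimal Σ' → ∀ ζ → ∣ Σ' ∣ₑ ≤ ∣ switch Σ' ζ ∣ₑ
minimal-≤-switch {Σ'} (_ , lowerBound) ζ = lowerBound (switch Σ' ζ) (balanced-deleting-switch Σ' ζ)

cut : (Vertex → Bool) → List Bool
cut ζ = map (λ e → coboundary ζ (proj₁ e) (proj₂ e)) edgeList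

-- Switching flips exactly the edges of the cut.
switch-reduces : ∀ Σ' ζ → ones (cut ζ) < onesOn (bitsOf Σ') (cut ζ) + onesOn (bitsOf Σ') (cut ζ) →
                 ∣ switch Σ' ζ ∣ₑ < ∣ Σ' ∣ₑ
switch-reduces Σ' ζ heavy = begin-strict
  ∣ switch Σ' ζ ∣ₑ                         ≡⟨ ∣∣ₑ≡ones-bitsOf (switch Σ' ζ) ⟩
  ones (bitsOf (switch Σ' ζ))              ≡⟨ cong ones (map-cong (λ e → switch-mem Σ' ζ (proj₁ e) (proj₂ e)) edgeList) ⟩
  ones (map (λ e → s e xor k e) edgeList)  <⟨ ones-xor-< s k edgeList heavy′ ⟩
  ones (bitsOf Σ')                         ≡⟨ ∣∣ₑ≡ones-bitsOf Σ' ⟨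
  ∣ Σ' ∣ₑ                                  ∎
  where
  open ≤-Reasoning
  s k : Edge → Bool
  s e = mem Σ' (proj₁ e) (proj₂ e)
  k e = coboundary ζ (proj₁ e) (proj₂ e)
  heavy′ : ones (cut ζ) < ones (map (λ e → s e ∧ k e) edgeList) + ones (map (λ e → s e ∧ k e) edgeList)
  heavy′ = subst (λ l → ones (cut ζ) < ones l + ones l) (zipWith-map-map _∧_ s k edgeList) heavy

minimal-light-cuts : ∀ {Σ'} → Minimal Σ' → ∀ ζ →
                     ¬ (ones (cut ζ) < onesOn (bitsOf Σ') (cut ζ) + onesOn (bitsOf Σ') (cut ζ))
minimal-light-cuts {Σ'} minimal ζ heavy =
  <-irrefl refl (<-≤-trans (switch-reduces Σ' ζ heavy) (minimal-≤-switch {Σ'} minimal ζ))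

-- Transport along automorphisms

Preserves-adj : (Vertex → Vertex) → Set
Preserves-adj f = ∀ u v → adj (f u) (f v) ≡ adj u v

Adj-preserved : ∀ f → Preserves-adj f → ∀ {u v} → Adj u v → Adj (f u) (f v)
Adj-preserved f preserves {u} {v} = subst T (sym (preserves u v))

Preserves-adj-inverse : ∀ (π : Permutation′ 10) → Preserves-adj (π ⟨$⟩ʳ_) → Preserves-adj (π ⟨$⟩ˡ_)
Preserves-adj-inverse π preserves u v =
  trans (sym (preserves (π ⟨$⟩ˡ u) (π ⟨$⟩ˡ v))) (cong₂ adj (inverseʳ π) (inverseʳ π))

Carries : (Vertex → Vertex) → EdgeSet → EdgeSet → Set
Carries f X Y = ∀ u v → Adj u v → mem Y (f u) (f v) ≡ mem X u v

Carries-inverse : ∀ (π : Permutation′ 10) {X Y} → Preserves-adj (π ⟨$⟩ʳ_) → Carries (π ⟨$⟩ʳ_) X Y →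
                  Carries (π ⟨$⟩ˡ_) Y X
Carries-inverse π {Y = Y} preserves carries u v uv =
  trans (sym (carries _ _ (Adj-preserved (π ⟨$⟩ˡ_) (Preserves-adj-inverse π preserves) uv)))
        (cong₂ (mem Y) (inverseʳ π) (inverseʳ π))

carries-from-edgeList : ∀ {f X Y} →
  All (λ e → mem Y (f (proj₁ e)) (f (proj₂ e)) ≡ mem X (proj₁ e) (proj₂ e)) edgeList → Carries f X Y
carries-from-edgeList {f} {X} {Y} agree u v uv =
  trans (sym (mem-ordered Y′ u v)) (trans (All.lookup agree (ordered-∈-edgeList u v uv)) (mem-ordered X u v))
  where
  Y′ : EdgeSet
  Y′ = record { mem = λ x y → mem Y (f x) (f y) ; sym = λ x y → EdgeSet.sym Y (f x) (f y) }

ClosedWalk : List Vertex → Set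
ClosedWalk c = All (λ e → Adj (proj₁ e) (proj₂ e)) (cycleEdges c)

cycleEdges-map : ∀ f c → cycleEdges (map f c) ≡ map (Product.map f f) (cycleEdges c)
cycleEdges-map f [] = refl
cycleEdges-map f (v ∷ vs) = trans (cong (zip (f v ∷ map f vs)) (sym (map-++ f vs [ v ])))
                                  (zip-map f f (v ∷ vs) (vs ++ [ v ]))

closedWalk-map : ∀ {f} → (∀ {u v} → Adj u v → Adj (f u) (f v)) → ∀ c → ClosedWalk c → ClosedWalk (map f c)
closedWalk-map {f} hom c walk = subst (All _) (sym (cycleEdges-map f c)) (AllP.map⁺ (All.map hom walk))

cycleNeg-carried : ∀ {f X Y} → Carries f X Y → ∀ c → ClosedWalk c → cycleNeg Y (map f c) ≡ cycleNeg X c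
cycleNeg-carried {f} {X} {Y} carries c walk =
  trans (cong (parity (mem Y)) (cycleEdges-map f c)) (parity-map (cycleEdges c) walk)
  where
  parity-map : ∀ es → All (λ e → Adj (proj₁ e) (proj₂ e)) es →
               parity (mem Y) (map (Product.map f f) es) ≡ parity (mem X) es
  parity-map [] [] = refl
  parity-map ((u , v) ∷ es) (a ∷ as) = cong₂ _xor_ (carries u v a) (parity-map es as)

balanced-pullback : ∀ {f S₁ S₂ T₁ T₂} → (∀ {x y} → f x ≡ f y → x ≡ y) → (∀ {u v} → Adj u v → Adj (f u) (f v)) →
                    Carries f S₁ S₂ → Carries f T₁ T₂ → BalancedAfterDeleting S₂ T₂ → BalancedAfterDeleting S₁ T₁
balanced-pullback {f} {S₁} {S₂} {T₂ = T₂} injective hom carriesS carriesT balanced c 3≤len unique avoids =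
  trans (sym (cycleNeg-carried {X = S₁} {S₂} carriesS c (All.map proj₁ avoids)))
        (balanced (map f c) (subst (3 ≤_) (sym (length-map f c)) 3≤len) (UniqueP.map⁺ injective unique) avoids′)
  where
  avoids′ : All (λ e → Adj (proj₁ e) (proj₂ e) × mem T₂ (proj₁ e) (proj₂ e) ≡ false) (cycleEdges (map f c))
  avoids′ = subst (All _) (sym (cycleEdges-map f c))
                  (AllP.map⁺ (All.map (λ (a , kept) → hom a , trans (carriesT _ _ a) kept) avoids))

⟦_⟧ : Bool → ℕ
⟦ true ⟧ = 1
⟦ false ⟧ = 0

length-filterᵇ-filterᵇ : ∀ {A : Set} (p q : A → Bool) xs →
                         length (filterᵇ q (filterᵇ p xs)) ≡ sum (map (λ x → ⟦ p x ∧ q x ⟧) xs)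
length-filterᵇ-filterᵇ p q [] = refl
length-filterᵇ-filterᵇ p q (x ∷ xs) with p x
... | false = length-filterᵇ-filterᵇ p q xs
... | true with q x
...   | true = cong suc (length-filterᵇ-filterᵇ p q xs)
...   | false = length-filterᵇ-filterᵇ p q xs

sum-cartesianProduct : ∀ {A B : Set} (f : A × B → ℕ) xs ys →
  sum (map f (cartesianProduct xs ys)) ≡ sum (map (λ x → sum (map (λ y → f (x , y)) ys)) xs)
sum-cartesianProduct f [] ys = refl
sum-cartesianProduct f (x ∷ xs) ys = begin
  sum (map f (map (x ,_) ys ++ cartesianProduct xs ys))
    ≡⟨ cong sum (map-++ f (map (x ,_) ys) _) ⟩
  sum (map f (map (x ,_) ys) ++ map f (cartesianProduct xs ys))
    ≡⟨ sum-++ (map f (map (x ,_) ys)) _ ⟩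
  sum (map f (map (x ,_) ys)) + sum (map f (cartesianProduct xs ys))
    ≡⟨ cong₂ _+_ (cong sum (sym (map-∘ ys))) (sum-cartesianProduct f xs ys) ⟩
  sum (map (λ y → f (x , y)) ys) + sum (map (λ x → sum (map (λ y → f (x , y)) ys)) xs)
    ∎
  where open ≡-Reasoning

sum-allFin : ∀ n (f : Fin n → ℕ) → sum (map f (allFin n)) ≡ ∑[ i < n ] f i
sum-allFin n f = trans (cong sum (map-tabulate id f)) (sum-tabulate f)
  where
  sum-tabulate : ∀ {n} (g : Fin n → ℕ) → sum (tabulate g) ≡ ∑[ i < n ] g i
  sum-tabulate {zero} g = refl
  sum-tabulate {suc n} g = cong (g zero +_) (sum-tabulate (g ∘ suc))

forward : EdgeSet → Vertex → Vertex → ℕ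
forward X u v = ⟦ (adj u v ∧ (toℕ u <ᵇ toℕ v)) ∧ mem X u v ⟧

∣∣ₑ-as-sum : ∀ X → ∣ X ∣ₑ ≡ ∑[ u < 10 ] ∑[ v < 10 ] forward X u v
∣∣ₑ-as-sum X = begin
  ∣ X ∣ₑ
    ≡⟨ length-filterᵇ-filterᵇ isEdge isIn (cartesianProduct (allFin 10) (allFin 10)) ⟩
  sum (map (λ e → forward X (proj₁ e) (proj₂ e)) (cartesianProduct (allFin 10) (allFin 10)))
    ≡⟨ sum-cartesianProduct (λ e → forward X (proj₁ e) (proj₂ e)) (allFin 10) (allFin 10) ⟩
  sum (map (λ u → sum (map (forward X u) (allFin 10))) (allFin 10))
    ≡⟨ sum-allFin 10 (λ u → sum (map (forward X u) (allFin 10))) ⟩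
  ∑[ u < 10 ] sum (map (forward X u) (allFin 10))
    ≡⟨ sum-cong-≗ (λ u → sum-allFin 10 (forward X u)) ⟩
  ∑[ u < 10 ] ∑[ v < 10 ] forward X u v
    ∎
  where
  open ≡-Reasoning
  isEdge isIn : Edge → Bool
  isEdge e = adj (proj₁ e) (proj₂ e) ∧ (toℕ (proj₁ e) <ᵇ toℕ (proj₂ e))
  isIn e = mem X (proj₁ e) (proj₂ e)

orientedCount : EdgeSet → ℕ
orientedCount X = ∑[ u < 10 ] ∑[ v < 10 ] ⟦ adj u v ∧ mem X u v ⟧

adjacent-ordered : ∀ u v → Adj u v → T ((toℕ u <ᵇ toℕ v) xor (toℕ v <ᵇ toℕ u))
adjacent-ordered = from-yes (all? λ u → all? λ v → T? (adj u v) →-dec T? ((toℕ u <ᵇ toℕ v) xor (toℕ v <ᵇ toℕ u)))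

split-by-order : ∀ a l g x → (T a → T (l xor g)) → ⟦ a ∧ x ⟧ ≡ ⟦ (a ∧ l) ∧ x ⟧ + ⟦ (a ∧ g) ∧ x ⟧
split-by-order false l     g     x _ = refl
split-by-order true  true  false x _ = sym (+-identityʳ ⟦ x ⟧)
split-by-order true  false true  x _ = refl
split-by-order true  true  true  x l⊕g = ⊥-elim (l⊕g tt)
split-by-order true  false false x l⊕g = ⊥-elim (l⊕g tt)

both-orientations : ∀ X u v → ⟦ adj u v ∧ mem X u v ⟧ ≡ forward X u v + forward X v u
both-orientations X u v rewrite adj-sym v u | EdgeSet.sym X v u =
  split-by-order (adj u v) (toℕ u <ᵇ toℕ v) (toℕ v <ᵇ toℕ u) (mem X u v) (adjacent-ordered u v)

orientedCount≡2∣∣ₑ : ∀ X → orientedCount X ≡ 2 * ∣ X ∣ₑ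
orientedCount≡2∣∣ₑ X = begin
  ∑[ u < 10 ] ∑[ v < 10 ] ⟦ adj u v ∧ mem X u v ⟧
    ≡⟨ sum-cong-≗ (λ u → sum-cong-≗ (both-orientations X u)) ⟩
  ∑[ u < 10 ] ∑[ v < 10 ] (forward X u v + forward X v u)
    ≡⟨ sum-cong-≗ (λ u → ∑-distrib-+ (forward X u) (λ v → forward X v u)) ⟩
  ∑[ u < 10 ] (∑[ v < 10 ] forward X u v + ∑[ v < 10 ] forward X v u)
    ≡⟨ ∑-distrib-+ (λ u → ∑[ v < 10 ] forward X u v) (λ u → ∑[ v < 10 ] forward X v u) ⟩
  ∑[ u < 10 ] ∑[ v < 10 ] forward X u v + ∑[ u < 10 ] ∑[ v < 10 ] forward X v u
    ≡⟨ cong (∑[ u < 10 ] ∑[ v < 10 ] forward X u v +_) (∑-comm (λ u v → forward X v u)) ⟩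
  ∑[ u < 10 ] ∑[ v < 10 ] forward X u v + ∑[ u < 10 ] ∑[ v < 10 ] forward X u v
    ≡⟨ cong₂ _+_ (sym (∣∣ₑ-as-sum X)) (trans (sym (∣∣ₑ-as-sum X)) (sym (+-identityʳ _))) ⟩
  2 * ∣ X ∣ₑ
    ∎
  where open ≡-Reasoning

orientedCount-carried : ∀ (π : Permutation′ 10) {X Y} → Preserves-adj (π ⟨$⟩ʳ_) → Carries (π ⟨$⟩ʳ_) X Y →
                        orientedCount Y ≡ orientedCount X
orientedCount-carried π {X} {Y} preserves carries = begin
  ∑[ u < 10 ] ∑[ v < 10 ] w Y u v                        ≡⟨ ∑-permute (λ u → ∑[ v < 10 ] w Y u v) π ⟩
  ∑[ u < 10 ] ∑[ v < 10 ] w Y (π ⟨$⟩ʳ u) v               ≡⟨ sum-cong-≗ (λ u → ∑-permute (w Y (π ⟨$⟩ʳ u)) π) ⟩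
  ∑[ u < 10 ] ∑[ v < 10 ] w Y (π ⟨$⟩ʳ u) (π ⟨$⟩ʳ v)      ≡⟨ sum-cong-≗ (λ u → sum-cong-≗ (pointwise u)) ⟩
  ∑[ u < 10 ] ∑[ v < 10 ] w X u v                        ∎
  where
  open ≡-Reasoning
  w : EdgeSet → Vertex → Vertex → ℕ
  w Z u v = ⟦ adj u v ∧ mem Z u v ⟧
  pointwise : ∀ u v → w Y (π ⟨$⟩ʳ u) (π ⟨$⟩ʳ v) ≡ w X u v
  pointwise u v rewrite preserves u v with adj u v in eq
  ... | true = cong ⟦_⟧ (carries u v (subst T (sym eq) tt))
  ... | false = refl

∣∣ₑ-carried : ∀ (π : Permutation′ 10) {X Y} → Preserves-adj (π ⟨$⟩ʳ_) → Carries (π ⟨$⟩ʳ_) X Y → ∣ Y ∣ₑ ≡ ∣ X ∣ₑ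
∣∣ₑ-carried π {X} {Y} preserves carries = *-cancelˡ-≡ ∣ Y ∣ₑ ∣ X ∣ₑ 2 (begin
  2 * ∣ Y ∣ₑ       ≡⟨ orientedCount≡2∣∣ₑ Y ⟨
  orientedCount Y  ≡⟨ orientedCount-carried π {X} {Y} preserves carries ⟩
  orientedCount X  ≡⟨ orientedCount≡2∣∣ₑ X ⟩
  2 * ∣ X ∣ₑ       ∎)
  where open ≡-Reasoning

image : Permutation′ 10 → EdgeSet → EdgeSet
image π X = record { mem = λ u v → mem X (π ⟨$⟩ˡ u) (π ⟨$⟩ˡ v) ; sym = λ u v → EdgeSet.sym X _ _ }

-- A balancing set T′ of S gives the balancing set image π T′ of A, of the same size.
minimal-≅ : ∀ {S A} → S ≅ A → Minimal A → Minimal S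
minimal-≅ {S} {A} (π , preserves , carries) (_ , lowerBound) = (S , refl , balanced-deleting-negatives S) , lower
  where
  π⁻¹-injective : ∀ {x y} → π ⟨$⟩ˡ x ≡ π ⟨$⟩ˡ y → x ≡ y
  π⁻¹-injective eq = trans (sym (inverseʳ π)) (trans (cong (π ⟨$⟩ʳ_) eq) (inverseʳ π))
  image-balanced : ∀ T′ → BalancedAfterDeleting S T′ → BalancedAfterDeleting A (image π T′)
  image-balanced T′ = balanced-pullback {S₁ = A} {S} {image π T′} {T′} π⁻¹-injective
    (Adj-preserved (π ⟨$⟩ˡ_) (Preserves-adj-inverse π preserves)) (Carries-inverse π {S} {A} preserves carries)
    (λ _ _ _ → refl)
  lower : ∀ T′ → BalancedAfterDeleting S T′ → negCount S ≤ ∣ T′ ∣ₑ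
  lower T′ balanced =
    subst₂ _≤_ (∣∣ₑ-carried π {S} {A} preserves carries)
               (∣∣ₑ-carried π {T′} {image π T′} preserves λ u v _ → cong₂ (mem T′) (inverseˡ π) (inverseˡ π))
               (lowerBound (image π T′) (image-balanced T′ balanced))

record _≈_ (Σ₁ Σ₂ : SignedPetersen) : Set where
  constructor mk≈
  field
    π : Permutation′ 10
    preserves : Preserves-adj (π ⟨$⟩ʳ_)
    signs : ∀ c → ClosedWalk c → cycleNeg Σ₂ (map (π ⟨$⟩ʳ_) c) ≡ cycleNeg Σ₁ c

≅⇒≈ : ∀ {Σ₁ Σ₂} → Σ₁ ≅ Σ₂ → Σ₁ ≈ Σ₂
≅⇒≈ {Σ₁} {Σ₂} (π , preserves , carries) = mk≈ π preserves (cycleNeg-carried {X = Σ₁} {Σ₂} carries)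

~⇒≈ : ∀ {Σ₁ Σ₂} → Σ₁ ~ Σ₂ → Σ₁ ≈ Σ₂
~⇒≈ {Σ₁} {Σ₂} (ζ , π , preserves , carries) =
  mk≈ π preserves λ c walk → trans (cycleNeg-carried {X = switch Σ₁ ζ} {Σ₂} carries c walk) (switch-cycleNeg Σ₁ ζ c)

≈-sym : ∀ {Σ₁ Σ₂} → Σ₁ ≈ Σ₂ → Σ₂ ≈ Σ₁
≈-sym {Σ₁} {Σ₂} (mk≈ π preserves signs) = mk≈ (flip π) preserves⁻¹ signs⁻¹
  where
  preserves⁻¹ = Preserves-adj-inverse π preserves
  signs⁻¹ : ∀ c → ClosedWalk c → cycleNeg Σ₁ (map (π ⟨$⟩ˡ_) c) ≡ cycleNeg Σ₂ c
  signs⁻¹ c walk =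
    trans (sym (signs (map (π ⟨$⟩ˡ_) c) (closedWalk-map (Adj-preserved (π ⟨$⟩ˡ_) preserves⁻¹) c walk)))
          (cong (cycleNeg Σ₂) (trans (sym (map-∘ c)) (trans (map-cong (λ _ → inverseʳ π) c) (map-id c))))

≈-trans : ∀ {Σ₁ Σ₂ Σ₃} → Σ₁ ≈ Σ₂ → Σ₂ ≈ Σ₃ → Σ₁ ≈ Σ₃
≈-trans {Σ₃ = Σ₃} (mk≈ π preservesπ signsπ) (mk≈ ρ preservesρ signsρ) =
  mk≈ (π ∘ₚ ρ) (λ u v → trans (preservesρ _ _) (preservesπ u v)) λ c walk →
    trans (cong (cycleNeg Σ₃) (map-∘ c))
          (trans (signsρ (map (π ⟨$⟩ʳ_) c) (closedWalk-map (Adj-preserved (π ⟨$⟩ʳ_) preservesπ) c walk))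
                 (signsπ c walk))

-- Frames separate the six switching classes

∃-adj : Vertex → (Vertex → Set) → Set
∃-adj x P = Σ Vertex λ y → Adj x y × P y

∃-adj? : ∀ x {P : Vertex → Set} → (∀ y → Dec (P y)) → Dec (∃-adj x P)
∃-adj? x P? = any? λ y → T? (adj x y) ×-dec P? y

negativePentagons : SignedPetersen → List Vertex → List Vertex → ℕ
negativePentagons Σ' xs zs = ⟦ cycleNeg Σ' xs ⟧ + ⟦ cycleNeg Σ' zs ⟧

-- A copy of the standard drawing of P (outer pentagon x₀…x₄, spokes xᵢzᵢ, inner pentagram z₀z₂z₄z₁z₃)
-- with n negative pentagons among its two pentagons.
Frame : SignedPetersen → ℕ → Set
Frame Σ' n =
  Σ Vertex λ x₀ → ∃-adj x₀ λ x₁ → ∃-adj x₁ λ x₂ → ∃-adj x₂ λ x₃ → ∃-adj x₃ λ x₄ → Adj x₄ x₀ ×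
  ∃-adj x₀ λ z₀ → ∃-adj z₀ λ z₂ → Adj x₂ z₂ × ∃-adj z₂ λ z₄ → Adj x₄ z₄ ×
  ∃-adj z₄ λ z₁ → Adj x₁ z₁ × ∃-adj z₁ λ z₃ → Adj x₃ z₃ × Adj z₃ z₀ ×
  negativePentagons Σ' (x₀ ∷ x₁ ∷ x₂ ∷ x₃ ∷ x₄ ∷ []) (z₀ ∷ z₂ ∷ z₄ ∷ z₁ ∷ z₃ ∷ []) ≡ n

frame? : ∀ Σ' n → Dec (Frame Σ' n)
frame? Σ' n =
  any? λ x₀ → ∃-adj? x₀ λ x₁ → ∃-adj? x₁ λ x₂ → ∃-adj? x₂ λ x₃ → ∃-adj? x₃ λ x₄ → T? (adj x₄ x₀) ×-dec
  ∃-adj? x₀ λ z₀ → ∃-adj? z₀ λ z₂ → T? (adj x₂ z₂) ×-dec ∃-adj? z₂ λ z₄ → T? (adj x₄ z₄) ×-dec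
  ∃-adj? z₄ λ z₁ → T? (adj x₁ z₁) ×-dec ∃-adj? z₁ λ z₃ → T? (adj x₃ z₃) ×-dec T? (adj z₃ z₀) ×-dec
  negativePentagons Σ' (x₀ ∷ x₁ ∷ x₂ ∷ x₃ ∷ x₄ ∷ []) (z₀ ∷ z₂ ∷ z₄ ∷ z₁ ∷ z₃ ∷ []) ℕ.≟ n

frame-≈ : ∀ {Σ₁ Σ₂ n} → Σ₁ ≈ Σ₂ → Frame Σ₁ n → Frame Σ₂ n
frame-≈ (mk≈ π preserves signs)
  (x₀ , x₁ , a₀₁ , x₂ , a₁₂ , x₃ , a₂₃ , x₄ , a₃₄ , a₄₀ ,
   z₀ , s₀ , z₂ , b₀₂ , s₂ , z₄ , b₂₄ , s₄ , z₁ , b₄₁ , s₁ , z₃ , b₁₃ , s₃ , b₃₀ , count) =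
  f x₀ , f x₁ , h a₀₁ , f x₂ , h a₁₂ , f x₃ , h a₂₃ , f x₄ , h a₃₄ , h a₄₀ ,
  f z₀ , h s₀ , f z₂ , h b₀₂ , h s₂ , f z₄ , h b₂₄ , h s₄ , f z₁ , h b₄₁ , h s₁ , f z₃ , h b₁₃ , h s₃ , h b₃₀ ,
  trans (cong₂ (λ s t → ⟦ s ⟧ + ⟦ t ⟧) (signs (x₀ ∷ x₁ ∷ x₂ ∷ x₃ ∷ x₄ ∷ []) (a₀₁ ∷ a₁₂ ∷ a₂₃ ∷ a₃₄ ∷ a₄₀ ∷ []))
                                       (signs (z₀ ∷ z₂ ∷ z₄ ∷ z₁ ∷ z₃ ∷ []) (b₀₂ ∷ b₂₄ ∷ b₄₁ ∷ b₁₃ ∷ b₃₀ ∷ [])))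
        count
  where
  f = π ⟨$⟩ʳ_
  h = Adj-preserved f preserves

frameProfile : SignedPetersen → List Bool
frameProfile Σ' = map (λ n → does (frame? Σ' n)) (0 ∷ 1 ∷ 2 ∷ [])

frameProfile-≈ : ∀ {Σ₁ Σ₂} → Σ₁ ≈ Σ₂ → frameProfile Σ₁ ≡ frameProfile Σ₂
frameProfile-≈ {Σ₁} {Σ₂} e =
  map-cong (λ n → does-⇔ (mk⇔ (frame-≈ e) (frame-≈ (≈-sym e))) (frame? Σ₁ n) (frame? Σ₂ n)) (0 ∷ 1 ∷ 2 ∷ [])

sixProfile : Fin 6 → List Bool
sixProfile zero                                = true  ∷ false ∷ false ∷ []
sixProfile (suc zero)                          = true  ∷ true  ∷ false ∷ []
sixProfile (suc (suc zero))                    = true  ∷ true  ∷ true  ∷ []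
sixProfile (suc (suc (suc zero)))              = false ∷ true  ∷ false ∷ []
sixProfile (suc (suc (suc (suc zero))))        = false ∷ true  ∷ true  ∷ []
sixProfile (suc (suc (suc (suc (suc zero)))))  = false ∷ false ∷ true  ∷ []

frameProfile-six : ∀ i → frameProfile (six i) ≡ sixProfile i
frameProfile-six = from-yes (all? λ i → ≡-dec Bool._≟_ (frameProfile (six i)) (sixProfile i))

sixProfile-injective : ∀ i j → sixProfile i ≡ sixProfile j → i ≡ j
sixProfile-injective = from-yes (all? λ i → all? λ j → ≡-dec Bool._≟_ (sixProfile i) (sixProfile j) →-dec i ≟ j)

six-≈-injective : ∀ {i j} → six i ≈ six j → i ≡ j
six-≈-injective {i} {j} e =
  sixProfile-injective i j (trans (sym (frameProfile-six i)) (trans (frameProfile-≈ {six i} {six j} e) (frameProfile-six j)))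

-- Exhaustive search over edge sets

module BitSearch (prune leaf : List Bool → Bool) where

  search : ℕ → List Bool → Bool
  search zero p = prune p ∨ leaf p
  search (suc n) p = prune p ∨ (search n (p ++ [ false ]) ∧ search n (p ++ [ true ]))

  search-sound : (∀ p q → T (prune p) → T (prune (p ++ q))) →
                 ∀ n p → T (search n p) → ∀ q → length q ≡ n → T (prune (p ++ q)) ⊎ T (leaf (p ++ q))
  search-sound prune-++ zero p found [] refl =
    subst (λ r → T (prune r) ⊎ T (leaf r)) (sym (++-identityʳ p)) (Equivalence.to T-∨ found)
  search-sound prune-++ (suc n) p found (b ∷ q) refl with Equivalence.to T-∨ found
  ... | inj₁ pruned = inj₁ (prune-++ p (b ∷ q) pruned)
  ... | inj₂ both = subst (λ r → T (prune r) ⊎ T (leaf r)) (++-assoc p [ b ] q)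
                          (search-sound prune-++ n (p ++ [ b ]) (branch b (Equivalence.to T-∧ both)) q refl)
    where
    branch : ∀ b → T (search n (p ++ [ false ])) × T (search n (p ++ [ true ])) → T (search n (p ++ [ b ]))
    branch false = proj₁
    branch true = proj₂

_≟ᵉ_ : (e f : Edge) → Dec (e ≡ f)
_≟ᵉ_ = ×-≡-dec _≟_ _≟_

lookupBit : List (Edge × Bool) → Edge → Bool
lookupBit [] e = false
lookupBit ((e′ , b) ∷ table) e = if does (e′ ≟ᵉ e) then b else lookupBit table e

lookupBit-tabulated : ∀ (f : Edge → Bool) {e} es → e ∈ es → lookupBit (map (λ e′ → e′ , f e′) es) e ≡ f e
lookupBit-tabulated f {e} (e′ ∷ es) e∈ with e′ ≟ᵉ e | e∈
... | yes refl | _ = refl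
... | no e′≢e | here e≡e′ = ⊥-elim (e′≢e (sym e≡e′))
... | no _ | there e∈es = lookupBit-tabulated f es e∈es

-- junk value false if uv is not an edge
edgeBit : List Bool → Vertex → Vertex → Bool
edgeBit a u v = lookupBit (zip edgeList a) (ordered u v)

edgeBit-bitsOf : ∀ X u v → Adj u v → edgeBit (bitsOf X) u v ≡ mem X u v
edgeBit-bitsOf X u v uv = begin
  lookupBit (zip edgeList (map memX edgeList)) (ordered u v)
    ≡⟨ cong (λ t → lookupBit t (ordered u v)) (zip-map-self memX edgeList) ⟩
  lookupBit (map (λ e → e , memX e) edgeList) (ordered u v)
    ≡⟨ lookupBit-tabulated memX edgeList (ordered-∈-edgeList u v uv) ⟩
  memX (ordered u v)
    ≡⟨ mem-ordered X u v ⟩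
  mem X u v
    ∎
  where
  open ≡-Reasoning
  memX : Edge → Bool
  memX e = mem X (proj₁ e) (proj₂ e)

-- Frustration indices of the six

pentagons : List (List Vertex)
pentagons =
  (# 0 ∷ # 7 ∷ # 3 ∷ # 4 ∷ # 9 ∷ []) ∷ (# 0 ∷ # 7 ∷ # 3 ∷ # 5 ∷ # 8 ∷ []) ∷ (# 0 ∷ # 7 ∷ # 6 ∷ # 1 ∷ # 9 ∷ []) ∷
  (# 0 ∷ # 7 ∷ # 6 ∷ # 2 ∷ # 8 ∷ []) ∷ (# 0 ∷ # 8 ∷ # 2 ∷ # 4 ∷ # 9 ∷ []) ∷ (# 0 ∷ # 8 ∷ # 5 ∷ # 1 ∷ # 9 ∷ []) ∷
  (# 1 ∷ # 5 ∷ # 3 ∷ # 4 ∷ # 9 ∷ []) ∷ (# 1 ∷ # 5 ∷ # 3 ∷ # 7 ∷ # 6 ∷ []) ∷ (# 1 ∷ # 5 ∷ # 8 ∷ # 2 ∷ # 6 ∷ []) ∷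
  (# 1 ∷ # 6 ∷ # 2 ∷ # 4 ∷ # 9 ∷ []) ∷ (# 2 ∷ # 4 ∷ # 3 ∷ # 5 ∷ # 8 ∷ []) ∷ (# 2 ∷ # 4 ∷ # 3 ∷ # 7 ∷ # 6 ∷ []) ∷ []

IsCycle : List Vertex → Set
IsCycle c = 3 ≤ length c × Unique c × ClosedWalk c

pentagons-are-cycles : All IsCycle pentagons
pentagons-are-cycles = from-yes (All.all? (λ c → 3 ℕ.≤? length c ×-dec unique? c ×-dec
                                                   All.all? (λ e → T? (adj (proj₁ e) (proj₂ e))) (cycleEdges c)) pentagons)

negativeAndAvoided : SignedPetersen → List Bool → List Vertex → Bool
negativeAndAvoided Σ' a c = cycleNeg Σ' c ∧ all (λ e → not (edgeBit a (proj₁ e) (proj₂ e))) (cycleEdges c)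

negativeAndAvoided-unbalanced : ∀ Σ' X c → c ∈ pentagons → T (negativeAndAvoided Σ' (bitsOf X) c) →
                                ¬ BalancedAfterDeleting Σ' X
negativeAndAvoided-unbalanced Σ' X c c∈ found balanced =
  let negative , avoided = Equivalence.to T-∧ found
      3≤len , unique , walk = All.lookup pentagons-are-cycles c∈
  in subst T (balanced c 3≤len unique (All.zipWith kept (walk , AllP.all⁺ _ (cycleEdges c) avoided))) negative
  where
  kept : ∀ {e} → Adj (proj₁ e) (proj₂ e) × T (not (edgeBit (bitsOf X) (proj₁ e) (proj₂ e))) →
         Adj (proj₁ e) (proj₂ e) × mem X (proj₁ e) (proj₂ e) ≡ false
  kept {u , v} (uv , notDeleted) = uv , trans (sym (edgeBit-bitsOf X u v uv)) (Equivalence.to T-not-≡ notDeleted)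

anyNegativeAndAvoided-unbalanced : ∀ Σ' X → T (any (negativeAndAvoided Σ' (bitsOf X)) pentagons) →
                                   ¬ BalancedAfterDeleting Σ' X
anyNegativeAndAvoided-unbalanced Σ' X found with find (AnyP.any⁻ (negativeAndAvoided Σ' (bitsOf X)) pentagons found)
... | c , c∈ , negative∧avoided = negativeAndAvoided-unbalanced Σ' X c c∈ negative∧avoided

-- k ≤ l(Σ') as soon as every set of fewer than k edges misses some negative pentagon.
module LowerBound (Σ' : SignedPetersen) (k : ℕ) where
  open BitSearch (λ p → k ≤ᵇ ones p) (λ a → any (negativeAndAvoided Σ' a) pentagons) public

  prune-++ : ∀ p q → T (k ≤ᵇ ones p) → T (k ≤ᵇ ones (p ++ q))
  prune-++ p q k≤p =
    ≤⇒≤ᵇ (≤-trans (≤ᵇ⇒≤ k (ones p) k≤p) (subst (ones p ≤_) (sym (ones-++ p q)) (m≤m+n (ones p) (ones q))))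

  -- No `with` here: abstracting over the proof of the search would normalise its (huge) type.
  frustration-≥ : T (search 15 []) → (X : EdgeSet) → BalancedAfterDeleting Σ' X → k ≤ ∣ X ∣ₑ
  frustration-≥ ok X balanced =
    [ (λ k≤ones → subst (k ≤_) (sym (∣∣ₑ≡ones-bitsOf X)) (≤ᵇ⇒≤ k _ k≤ones))
    , (λ found → ⊥-elim (anyNegativeAndAvoided-unbalanced Σ' X found balanced))
    ]′ (search-sound prune-++ 15 [] ok (bitsOf X) (length-map (λ e → mem X (proj₁ e) (proj₂ e)) edgeList))

minimal-by-search : ∀ Σ' → T (LowerBound.search Σ' (ones (bitsOf Σ')) 15 []) → Minimal Σ'
minimal-by-search Σ' ok = (Σ' , refl , balanced-deleting-negatives Σ') , λ X balanced →
  subst (_≤ ∣ X ∣ₑ) (sym (∣∣ₑ≡ones-bitsOf Σ')) (LowerBound.frustration-≥ Σ' (ones (bitsOf Σ')) ok X balanced)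

six-minimal : ∀ i → Minimal (six i)
six-minimal i =
  minimal-by-search (six i) (from-yes (all? λ j → T? (LowerBound.search (six j) (ones (bitsOf (six j))) 15 [])) i)

insertions : ∀ {A : Set} → A → List A → List (List A)
insertions x [] = [ [ x ] ]
insertions x (y ∷ ys) = (x ∷ y ∷ ys) ∷ map (y ∷_) (insertions x ys)

orderings : ∀ {A : Set} → List A → List (List A)
orderings [] = [ [] ]
orderings (x ∷ xs) = concatMap (insertions x) (orderings xs)

-- junk value zero past the end of σ
at : List (Fin 5) → ℕ → Fin 5
at [] _ = zero
at (x ∷ xs) zero = x
at (x ∷ xs) (suc i) = at xs i

-- the vertex {i, j}; junk value zero if i = j
vertexOf : Fin 5 → Fin 5 → Vertex
vertexOf i j = fromMaybe zero (findᵇ (λ v → sameSubset (pair v)) (allFin 10))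
  where
  sameSubset : Fin 5 × Fin 5 → Bool
  sameSubset (k , l) = ((k == i) ∧ (l == j)) ∨ ((k == j) ∧ (l == i))

-- A permutation σ of {1,…,5} acts on the 2-subsets, that is on the vertices. This gives the 120 automorphisms of P;
-- only the fact that they are automorphisms is checked and used.
induced : List (Fin 5) → Vertex → Vertex
induced σ v = vertexOf (at σ (toℕ (proj₁ (pair v)))) (at σ (toℕ (proj₂ (pair v))))

automorphismTables : List (Vec Vertex 10)
automorphismTables = map (λ σ → Vec.tabulate (induced σ)) (orderings (allFin 5))

preimage : Vec Vertex 10 → Vertex → Vertex
preimage t y = fromMaybe zero (findᵇ (λ x → does (Vec.lookup t x ≟ y)) (allFin 10))

IsAutomorphism : Vec Vertex 10 → Set
IsAutomorphism t =
  StrictlyInverseˡ _≡_ (Vec.lookup t) (preimage t) × StrictlyInverseʳ _≡_ (Vec.lookup t) (preimage t) ×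
  Preserves-adj (Vec.lookup t)

automorphismTables-valid : All IsAutomorphism automorphismTables
automorphismTables-valid = from-yes (All.all? isAutomorphism? automorphismTables)
  where
  isAutomorphism? : ∀ t → Dec (IsAutomorphism t)
  isAutomorphism? t =
    all? (λ y → Vec.lookup t (preimage t y) ≟ y) ×-dec all? (λ x → preimage t (Vec.lookup t x) ≟ x) ×-dec
    all? (λ u → all? λ v → adj (Vec.lookup t u) (Vec.lookup t v) Bool.≟ adj u v)

toPermutation : ∀ {t} → IsAutomorphism t → Permutation′ 10
toPermutation {t} (inverse₁ , inverse₂ , _) = permutation (Vec.lookup t) (preimage t) inverse₁ inverse₂

-- Classification of the minimal signatures

neighbours : Vertex → List Vertex
neighbours v = filterᵇ (adj v) (allFin 10)

-- Single vertices and 2-paths u v w (cuts of 3 and 5 edges): switching these already rules out every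
-- non-minimal signature.
switchingSets : List (List Vertex)
switchingSets = concatMap (λ v → [ v ] ∷ paths v (neighbours v)) (allFin 10)
  where
  paths : Vertex → List Vertex → List (List Vertex)
  paths v [] = []
  paths v (u ∷ us) = map (λ w → u ∷ v ∷ w ∷ []) us ++ paths v us

_∈ᵇ_ : Vertex → List Vertex → Bool
x ∈ᵇ X = any (x ≡ᵇ_) X

switchingCuts : List (List Bool)
switchingCuts = map (λ X → cut (_∈ᵇ X)) switchingSets

AreCuts : List (List Bool) → Set
AreCuts cuts = ∀ {m} → m ∈ cuts → Σ (Vertex → Bool) λ ζ → m ≡ cut ζ

-- The tables and cuts are parameters so that the search evaluates them only once.
module Classification (tables : List (Vec Vertex 10)) (cuts : List (List Bool)) where

  heavyIn : List Bool → List Bool → Bool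
  heavyIn p m = ones m <ᵇ onesOn p m + onesOn p m

  heavyCut : List Bool → Bool
  heavyCut p = any (heavyIn p) cuts

  negativeEdges : List Bool → List Edge
  negativeEdges a = map proj₁ (filterᵇ proj₂ (zip edgeList a))

  agreesWith : Fin 6 → Vec Vertex 10 → Edge × Bool → Bool
  agreesWith i t (e , b) = ⌊ mem (six i) (Vec.lookup t (proj₁ e)) (Vec.lookup t (proj₂ e)) Bool.≟ b ⌋

  agreesWith-sound : ∀ i t e b → T (agreesWith i t (e , b)) →
                     mem (six i) (Vec.lookup t (proj₁ e)) (Vec.lookup t (proj₂ e)) ≡ b
  agreesWith-sound i t e b = toWitness

  negativesMapped : List Bool → Fin 6 → Vec Vertex 10 → Bool
  negativesMapped a i t = all (λ e → mem (six i) (Vec.lookup t (proj₁ e)) (Vec.lookup t (proj₂ e))) (negativeEdges a)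

  -- The first conjunct, like the size filter below, only prunes the search.
  isomorphicVia : List Bool → Fin 6 → Vec Vertex 10 → Bool
  isomorphicVia a i t = negativesMapped a i t ∧ all (agreesWith i t) (zip edgeList a)

  isomorphicVia-agrees : ∀ a i t → T (isomorphicVia a i t) → T (all (agreesWith i t) (zip edgeList a))
  isomorphicVia-agrees a i t iso = proj₂ (Equivalence.to (T-∧ {negativesMapped a i t}) iso)

  sameSize : List Bool → List (Fin 6)
  sameSize a = filterᵇ (λ i → ones a ℕ.≡ᵇ ones (bitsOf (six i))) (allFin 6)

  isomorphicToSix : List Bool → Bool
  isomorphicToSix a = any (λ i → any (isomorphicVia a i) tables) (sameSize a)

  open BitSearch heavyCut isomorphicToSix public

  heavyCut-++ : ∀ p q → T (heavyCut p) → T (heavyCut (p ++ q))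
  heavyCut-++ p q heavy = AnyP.any⁺ (heavyIn (p ++ q)) (Any.map heavier (AnyP.any⁻ (heavyIn p) cuts heavy))
    where
    heavier : ∀ {m} → T (heavyIn p m) → T (heavyIn (p ++ q) m)
    heavier {m} h = <⇒<ᵇ (<-≤-trans (<ᵇ⇒< _ _ h) (+-mono-≤ (onesOn-++ p q m) (onesOn-++ p q m)))

  heavyCut-not-minimal : AreCuts cuts → ∀ {S} → Minimal S → ¬ T (heavyCut (bitsOf S))
  heavyCut-not-minimal cut-of {S} minimal heavy with find (AnyP.any⁻ (heavyIn (bitsOf S)) cuts heavy)
  ... | m , m∈ , heavyM with cut-of m∈
  ...   | ζ , refl = minimal-light-cuts {S} minimal ζ (<ᵇ⇒< _ _ heavyM)

  isomorphicToSix-sound : All IsAutomorphism tables → ∀ S → T (isomorphicToSix (bitsOf S)) → Σ (Fin 6) λ i → S ≅ six i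
  isomorphicToSix-sound valid S found
    with find (AnyP.any⁻ (λ i → any (isomorphicVia (bitsOf S) i) tables) (sameSize (bitsOf S)) found)
  ... | i , _ , foundI with find (AnyP.any⁻ (isomorphicVia (bitsOf S) i) tables foundI)
  ...   | t , t∈ , iso =
    i , toPermutation {t} automorphism , proj₂ (proj₂ automorphism) ,
    carries-from-edgeList {Vec.lookup t} {S} {six i} (All.map (λ {e} → agreesWith-sound i t e (memS e)) agreement)
    where
    automorphism = All.lookup valid t∈
    memS : Edge → Bool
    memS e = mem S (proj₁ e) (proj₂ e)
    agreement : All (λ e → T (agreesWith i t (e , memS e))) edgeList
    agreement = AllP.map⁻ (subst (All (T ∘ agreesWith i t)) (zip-map-self memS edgeList)
      (AllP.all⁺ (agreesWith i t) (zip edgeList (bitsOf S)) (isomorphicVia-agrees (bitsOf S) i t iso)))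

  classify : All IsAutomorphism tables → AreCuts cuts → T (search 15 []) → ∀ S → Minimal S → Σ (Fin 6) λ i → S ≅ six i
  classify valid cut-of ok S minimal =
    [ (λ heavy → ⊥-elim (heavyCut-not-minimal cut-of {S} minimal heavy)) , isomorphicToSix-sound valid S ]′
      (search-sound heavyCut-++ 15 [] ok (bitsOf S) (length-map (λ e → mem S (proj₁ e) (proj₂ e)) edgeList))

minimal-classification : ∀ S → Minimal S → Σ (Fin 6) λ i → S ≅ six i
minimal-classification = Classification.classify automorphismTables switchingCuts automorphismTables-valid cut-of tt
  where
  cut-of : AreCuts switchingCuts
  cut-of m∈ = let X , _ , m≡cut = ∈-map⁻ (λ X → cut (_∈ᵇ X)) {xs = switchingSets} m∈ in (_∈ᵇ X) , m≡cut

minimal-in-switching-class : ∀ i S → Minimal S → S ~ six i → S ≅ six i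
minimal-in-switching-class i S minimal S~six = same-class (minimal-classification S minimal)
  where
  -- not `with`, for the reason given at frustration-≥
  same-class : Σ (Fin 6) (λ j → S ≅ six j) → S ≅ six i
  same-class (j , S≅six) =
    subst (λ k → S ≅ six k) (six-≈-injective {j} {i} (≈-trans (≈-sym (≅⇒≈ {S} S≅six)) (~⇒≈ {S} S~six))) S≅six

theorem7p2 :
    ((S : SignedPetersen) → Minimal S ⇔ Σ (Fin 6) (λ i → S ≅ six i)) ×
    ((i j : Fin 6) → six i ≅ six j → i ≡ j) ×
    ((i : Fin 6) (S : SignedPetersen) → Minimal S → S ~ six i → S ≅ six i) ×
    FrustrationIndex +P 0 × FrustrationIndex P₁ 1 ×
    FrustrationIndex P₂₂ 2 × FrustrationIndex P₂₃ 2 ×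
    FrustrationIndex P₃₂ 3 × FrustrationIndex P₃₃ 3
theorem7p2 =
  (λ S → mk⇔ (minimal-classification S) (λ (i , S≅six) → minimal-≅ {S} {six i} S≅six (six-minimal i))) ,
  (λ i j six≅six → six-≈-injective {i} {j} (≅⇒≈ six≅six)) ,
  minimal-in-switching-class ,
  six-minimal (# 0) , six-minimal (# 1) , six-minimal (# 2) , six-minimal (# 4) , six-minimal (# 3) , six-minimal (# 5)
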